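{- Let $\mathcal P$ be an additive induced-hereditary hypergraph property and let $G,H$ be $\mathcal P$-strict, uniquely $\mathcal P$-decomposable hypergraphs with $dec_{\mathcal P}(G)=dec_{\mathcal P}(H)=dec(\mathcal P)$. If $G\le H$, then each ind-part of $G$ is an induced-subhypergraph of a distinct ind-part of $H$.
   Context: All hypergraphs are finite, without loops or multiple edges; each edge is an ordered tuple $(v_1,\dots,v_r;c)$ of $r\ge 2$ distinct vertices together with a colour $c$, and isomorphisms must preserve the order and colour of edges. For $U\subseteq V(H)$, $H[U]$ is the hypergraph on $U$ whose edges are those edges of $H$ all of whose vertices lie in $U$; $G\le H$ means $G$ is isomorphic to $H[U]$ for some $U$. A property is a nonempty isomorphism-closed class of hypergraphs (the null hypergraph is regarded as belonging to every property); it is induced-hereditary if closed under $\le$, and additive if closed under disjoint unions. For hypergraphs $G_1,\dots,G_n$ on pairwise disjoint vertex sets, $G_1*\cdots*G_n$ is the set of all hypergraphs $H$ with $V(H)=\bigcup_i V(G_i)$ and $H[V(G_i)]=G_i$ for all $i$. $kG$ is the disjoint union of $k$ copies of $G$; $K_1$ is the one-vertex hypergraph. A $\mathcal P$-decomposition of $G$ with $n$ parts is a partition $(V_1,\dots,V_n)$ of $V(G)$ into nonempty sets such that $kG[V_1]*\cdots*kG[V_n]\subseteq\mathcal P$ for every positive integer $k$. $dec_{\mathcal P}(G)$ is the maximum number of parts in a $\mathcal P$-decomposition of $G$ ($0$ if $G\notin\mathcal P$). $G$ is $\mathcal P$-strict if $G\in\mathcal P$ but $G*K_1\not\subseteq\mathcal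 P$. $dec(\mathcal P)=\min\{dec_{\mathcal P}(G): G\text{ is }\mathcal P\text{ -strict}\}$. $G$ is uniquely $\mathcal P$-decomposable if it has exactly one $\mathcal P$-decomposition $(V_1,\dots,V_n)$ with $n=dec_{\mathcal P}(G)$ parts; the hypergraphs $G[V_1],\dots,G[V_n]$ are then called the ind-parts of $G$. -}

module Defs where

open import Level using (0ℓ)
open import Data.Nat using (ℕ; zero; suc; _≤_)
open import Data.Fin using (Fin; zero; suc)
open import Data.Vec using (Vec; map; lookup)
open import Data.List using (List)
open import Data.List.Membership.Propositional using (_∈_)
open import Data.Product using (Σ; _×_; _,_; proj₁; proj₂; ∃)
open import Data.Sum using (_⊎_; inj₁; inj₂)
open import Data.Unit using (⊤)
open import Data.Empty using (⊥)
open import Relation.Nullary using (¬_)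
open import Relation.Binary.PropositionalEquality using (_≡_)
open import Function using (_∘_)
open import Function.Bundles using (_↔_; Inverse)
open import Function.Definitions using (Injective)

_⇔_ : Set → Set → Set
A ⇔ B = (A → B) × (B → A)

-- Hypergraphs with edge colours from C.
-- E r vs c : (vs ; c) is an edge (vs an ordered r-tuple of vertices).
-- Finiteness and validity of edges are recorded separately in IsFinHG.

record Hypergraph (C : Set) : Set₁ where
  field
    V : Set
    E : (r : ℕ) → Vec V r → C → Set
open Hypergraph public

Distinct : {A : Set} {r : ℕ} → Vec A r → Set
Distinct {r = r} vs = (i j : Fin r) → lookup vs i ≡ lookup vs j → i ≡ j

-- A (finite) hypergraph in the sense of the paper: finitely many vertices,
-- finitely many edges (finitely many colours used; arities are bounded by
-- distinctness), every edge has r ≥ 2 distinct vertices.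
IsFinHG : {C : Set} → Hypergraph C → Set
IsFinHG {C} G =
  (Σ ℕ λ n → V G ↔ Fin n)
  × (Σ (List C) λ cs → ∀ r vs c → E G r vs c → c ∈ cs)
  × (∀ r vs c → E G r vs c → (2 ≤ r) × Distinct vs)

_≅_ : {C : Set} → Hypergraph C → Hypergraph C → Set
G ≅ H = Σ (V G ↔ V H) λ f →
  ∀ r vs c → E G r vs c ⇔ E H r (map (Inverse.to f) vs) c

-- G ≤ H : G is isomorphic to H[U] for some U (U = image of f).
_≤ᴴ_ : {C : Set} → Hypergraph C → Hypergraph C → Set
G ≤ᴴ H = Σ (V G → V H) λ f → Injective _≡_ _≡_ f ×
  (∀ r vs c → E G r vs c ⇔ E H r (map f vs) c)

induced : {C : Set} → (H : Hypergraph C) → (V H → Set) → Hypergraph C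
induced H U = record
  { V = Σ (V H) U
  ; E = λ r vs c → E H r (map proj₁ vs) c }

_⊎ᴴ_ : {C : Set} → Hypergraph C → Hypergraph C → Hypergraph C
G ⊎ᴴ H = record
  { V = V G ⊎ V H
  ; E = λ r vs c →
      (Σ (Vec (V G) r) λ ws → (vs ≡ map inj₁ ws) × E G r ws c)
      ⊎ (Σ (Vec (V H) r) λ ws → (vs ≡ map inj₂ ws) × E H r ws c) }

copies : {C : Set} → ℕ → Hypergraph C → Hypergraph C
copies k G = record
  { V = Fin k × V G
  ; E = λ r vs c → Σ (Fin k) λ j → Σ (Vec (V G) r) λ ws →
          (vs ≡ map (j ,_) ws) × E G r ws c }

K₁ : {C : Set} → Hypergraph C
K₁ = record { V = ⊤ ; E = λ _ _ _ → ⊥ }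

-- H ∈ G_1 * ... * G_n  (the G_i are made disjoint by taking the vertex
-- set Σ i. V(G_i); H is any hypergraph identified with it by a bijection φ,
-- and H[V(G_i)] = G_i).

_∈Join_ : {C : Set} {n : ℕ} → Hypergraph C → (Fin n → Hypergraph C) → Set
_∈Join_ {n = n} H Gs = Σ (V H ↔ Σ (Fin n) (V ∘ Gs)) λ φ →
  ∀ i r vs c → E H r (map (λ v → Inverse.from φ (i , v)) vs) c ⇔ E (Gs i) r vs c

Property : Set → Set₁
Property C = Hypergraph C → Set

JoinSubset : {C : Set} {n : ℕ} → Property C → (Fin n → Hypergraph C) → Set₁
JoinSubset P Gs = ∀ H → IsFinHG H → H ∈Join Gs → P H

IsProperty : {C : Set} → Property C → Set₁
IsProperty {C} P =
  (Σ (Hypergraph C) λ G → IsFinHG G × P G)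
  × (∀ G H → IsFinHG G → IsFinHG H → G ≅ H → P G → P H)

InducedHereditary : {C : Set} → Property C → Set₁
InducedHereditary P = ∀ G H → IsFinHG G → IsFinHG H → G ≤ᴴ H → P H → P G

Additive : {C : Set} → Property C → Set₁
Additive P = ∀ G H → IsFinHG G → IsFinHG H → P G → P H → P (G ⊎ᴴ H)

-- Decompositions.  A partition (V_1,...,V_n) of V(G) is given by the map
-- p : V(G) → Fin n (V_i = p⁻¹(i)), required surjective (nonempty parts).

part : {C : Set} {n : ℕ} → (G : Hypergraph C) → (V G → Fin n) → Fin n → Hypergraph C
part G p i = induced G (λ v → p v ≡ i)

IsDecomp : {C : Set} → Property C → (G : Hypergraph C) → (n : ℕ) → (V G → Fin n) → Set₁
IsDecomp P G n p =
  (∀ i → ∃ λ v → p v ≡ i)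
  × (∀ k → 1 ≤ k → JoinSubset P (λ i → copies k (part G p i)))

DecIs : {C : Set} → Property C → Hypergraph C → ℕ → Set₁
DecIs P G d =
  (¬ P G × d ≡ 0)
  ⊎ (P G × (Σ (V G → Fin d) (IsDecomp P G d))
         × (∀ m (q : V G → Fin m) → IsDecomp P G m q → m ≤ d))

pairFam : {C : Set} → Hypergraph C → Hypergraph C → Fin 2 → Hypergraph C
pairFam G H zero = G
pairFam G H (suc _) = H

Strict : {C : Set} → Property C → Hypergraph C → Set₁
Strict P G = P G × ¬ JoinSubset P (pairFam G K₁)

DecProp : {C : Set} → Property C → ℕ → Set₁
DecProp {C} P d =
  (Σ (Hypergraph C) λ G → IsFinHG G × Strict P G × DecIs P G d)
  × (∀ G m → IsFinHG G → Strict P G → DecIs P G m → d ≤ m)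

-- Uniquely P-decomposable: exactly one decomposition with dec_P(G) parts,
-- partitions being unordered (equal up to a permutation of part labels).
UniquelyDecomposable : {C : Set} → Property C → Hypergraph C → Set₁
UniquelyDecomposable P G = Σ ℕ λ n → DecIs P G n ×
  (Σ (V G → Fin n) λ p → IsDecomp P G n p ×
     (∀ q → IsDecomp P G n q →
        Σ (Fin n ↔ Fin n) λ σ → ∀ v → q v ≡ Inverse.to σ (p v)))

{-# OPTIONS --safe #-}
module Submission where

-- Restricting the decomposition pH of H along the embedding f : G ≤ H gives a
-- partition pH ∘ f of G, and every member of kG[V₁] * ... * kG[V_d] is an
-- induced subhypergraph of a member of kH[V₁] * ... * kH[V_d] (add the missing
-- vertices and edges of kH block by block), so pH ∘ f is a P-decomposition of G
-- as soon as all of its parts are nonempty.  They are: if f missed the part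
-- V_i, placing the vertex of K₁ in V_i would show G * K₁ ⊆ P, contradicting
-- strictness.  Since dec_P(G) = d and G is uniquely decomposable, pG is a
-- relabelling τ of pH ∘ f, and f maps the part pG⁻¹(i) into pH⁻¹(τ i).

open import Defs
open import Data.Nat using (ℕ; _≤_; z≤n; s≤s; _*_)
open import Data.Nat.Properties using (≤-antisym)
open import Data.Fin using (Fin; zero; suc; _≟_)
open import Data.Fin.Properties using (any?; *↔×)
open import Data.Vec using (Vec; []; _∷_; map; lookup)
open import Data.Vec.Properties using (∷-injective; map-∘; map-cong; lookup-map)
open import Data.List using (_++_)
open import Data.List.Membership.Propositional using (_∈_)
open import Data.List.Membership.Propositional.Properties using (∈-++⁺ˡ; ∈-++⁺ʳ)
open import Data.Product using (Σ; _×_; _,_; proj₁; proj₂; ∃; map₂)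
open import Data.Product.Properties using (Σ-≡,≡←≡)
open import Data.Product.Function.NonDependent.Propositional using (_×-↔_)
open import Data.Sum using (_⊎_; inj₁; inj₂)
open import Data.Unit using (tt)
open import Data.Empty using (⊥-elim)
open import Relation.Nullary using (¬_; yes; no)
open import Relation.Binary.PropositionalEquality
open import Function using (_∘_; id)
open import Function.Bundles using (_↔_; Inverse; Injection; mk↔ₛ′)
open import Function.Definitions using (Injective)
open import Function.Properties.Inverse using (↔-refl; ↔-sym; ↔-trans; ↔⇒↣; to-from)
open import Axiom.UniquenessOfIdentityProofs using (module Decidable⇒UIP)

open Inverse using (to; from; strictlyInverseʳ)

to-injective : ∀ {A B : Set} (φ : A ↔ B) → Injective _≡_ _≡_ (to φ)
to-injective φ = Injection.injective (↔⇒↣ φ)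

from-injective : ∀ {A B : Set} (φ : A ↔ B) → Injective _≡_ _≡_ (from φ)
from-injective φ = to-injective (↔-sym φ)

⇔-trans : ∀ {A B D : Set} → A ⇔ B → B ⇔ D → A ⇔ D
⇔-trans (f , f⁻¹) (g , g⁻¹) = g ∘ f , f⁻¹ ∘ g⁻¹

E-cong : ∀ {C} (H : Hypergraph C) {r c} {vs ws : Vec (V H) r} → vs ≡ ws → E H r vs c ⇔ E H r ws c
E-cong H refl = id , id

map-injective : ∀ {A B : Set} {f : A → B} → Injective _≡_ _≡_ f → ∀ {r} → Injective _≡_ _≡_ (map {n = r} f)
map-injective f-inj {x = []}     {[]}     _  = refl
map-injective f-inj {x = x ∷ xs} {y ∷ ys} eq =
  cong₂ _∷_ (f-inj (proj₁ (∷-injective eq))) (map-injective f-inj (proj₂ (∷-injective eq)))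

map-pullback : ∀ {A B D Z : Set} {g : A → D} {h : B → D} {a : Z → A} {b : Z → B} →
  (∀ {x y} → g x ≡ h y → Σ Z λ z → x ≡ a z × y ≡ b z) →
  ∀ {r} {xs : Vec A r} {ys : Vec B r} →
  map g xs ≡ map h ys → Σ (Vec Z r) λ zs → xs ≡ map a zs × ys ≡ map b zs
map-pullback factor {xs = []}     {[]}     _  = [] , refl , refl
map-pullback factor {xs = x ∷ xs} {y ∷ ys} eq
  with factor (proj₁ (∷-injective eq)) | map-pullback factor (proj₂ (∷-injective eq))
... | z , refl , refl | zs , refl , refl = z ∷ zs , refl , refl

map₂-fibre : ∀ {A : Set} {B B′ : A → Set} (f : ∀ {a} → B a → B′ a) {a} {t : Σ A B} {u : B′ a} →
  map₂ f t ≡ (a , u) → Σ (B a) λ z → t ≡ (a , z) × u ≡ f z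
map₂-fibre f refl = _ , refl , refl

Distinct-map : ∀ {A B : Set} {f : A → B} → Injective _≡_ _≡_ f →
  ∀ {r} {vs : Vec A r} → Distinct vs → Distinct (map f vs)
Distinct-map {f = f} f-inj {vs = vs} distinct i j eq =
  distinct i j (f-inj (trans (sym (lookup-map i f vs)) (trans eq (lookup-map j f vs))))

edge-nonconstant : ∀ {C} {X : Hypergraph C} → IsFinHG X →
  ∀ {r ws c} → E X r ws c → (x : V X) → ¬ (∀ m → lookup ws m ≡ x)
edge-nonconstant (_ , _ , valid) e x constant with valid _ _ _ e
... | s≤s (s≤s _) , distinct with distinct zero (suc zero) (trans (constant zero) (sym (constant (suc zero))))
... | ()

≤ᴴ-trans : ∀ {C} {F G H : Hypergraph C} → F ≤ᴴ G → G ≤ᴴ H → F ≤ᴴ H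
≤ᴴ-trans {H = H} (f , f-inj , f-edges) (g , g-inj , g-edges) =
  g ∘ f , f-inj ∘ g-inj , λ r vs c →
    ⇔-trans (f-edges r vs c) (⇔-trans (g-edges r (map f vs) c) (E-cong H (sym (map-∘ g f vs))))

≤ᴴ-copies : ∀ {C} {G : Hypergraph C} {k} → Fin k → G ≤ᴴ copies k G
≤ᴴ-copies {G = G} j = (j ,_) , (λ { refl → refl }) , λ r vs c → (λ e → j , vs , refl , e) , copy-edge
  where
  copy-edge : ∀ {r vs c} → E (copies _ G) r (map (j ,_) vs) c → E G r vs c
  copy-edge (j′ , ws , eq , e) with map-pullback {a = id} {b = id} (λ { refl → _ , refl , refl }) eq
  ... | zs , refl , refl = e

copies-mono : ∀ {C} {G H : Hypergraph C} {k} → G ≤ᴴ H → copies k G ≤ᴴ copies k H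
copies-mono {G = G} {H} {k} (f , f-inj , f-edges) = map₂ f , map₂-f-injective , λ r vs c → forth , back
  where
  map₂-f-injective : Injective _≡_ _≡_ (map₂ {A = Fin k} f)
  map₂-f-injective {j , x} {j′ , y} eq with Σ-≡,≡←≡ eq
  ... | refl , fx≡fy = cong (j ,_) (f-inj fx≡fy)
  forth : ∀ {r vs c} → E (copies k G) r vs c → E (copies k H) r (map (map₂ f) vs) c
  forth {r} {c = c} (j , ws , refl , e) =
    j , map f ws , trans (sym (map-∘ (map₂ f) (j ,_) ws)) (map-∘ (j ,_) f ws) , proj₁ (f-edges r ws c) e
  back : ∀ {r vs c} → E (copies k H) r (map (map₂ f) vs) c → E (copies k G) r vs c
  back {r} {c = c} (j , ws , eq , e) with map-pullback (map₂-fibre f) eq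
  ... | zs , refl , refl = j , zs , refl , proj₂ (f-edges r zs c) e

copies-isFinHG : ∀ {C} {H : Hypergraph C} k → IsFinHG H → IsFinHG (copies k H)
copies-isFinHG {H = H} k ((n , φ) , (cs , colours) , valid) =
  (k * n , ↔-trans (↔-refl ×-↔ φ) (↔-sym *↔×)) , (cs , λ { r _ c (_ , ws , _ , e) → colours r ws c e }) , copy-valid
  where
  copy-valid : ∀ r vs c → E (copies k H) r vs c → 2 ≤ r × Distinct vs
  copy-valid r _ c (j , ws , refl , e) with valid r ws c e
  ... | 2≤r , distinct = 2≤r , Distinct-map {f = j ,_} (λ { refl → refl }) {vs = ws} distinct

∈Join-parts : ∀ {C} (X : Hypergraph C) {n} (q : V X → Fin n) → X ∈Join part X q
∈Join-parts X q =
  mk↔ₛ′ (λ x → q x , x , refl) (λ (_ , x , _) → x) (λ { (_ , _ , refl) → refl }) (λ _ → refl) ,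
  λ _ _ _ _ → id , id

copies-∈Join-parts : ∀ {C} (H : Hypergraph C) {n} (p : V H → Fin n) k →
  copies k H ∈Join (λ i → copies k (part H p i))
copies-∈Join-parts H {n} p k = φ , λ i r vs c → forth , back
  where
  φ : (Fin k × V H) ↔ (Σ (Fin n) λ i → Fin k × Σ (V H) λ v → p v ≡ i)
  φ = mk↔ₛ′ (λ (j , v) → p v , j , v , refl) (λ (_ , j , v , _) → j , v)
        (λ { (_ , _ , _ , refl) → refl }) (λ _ → refl)
  forth : ∀ {i r vs c} → E (copies k H) r (map (λ u → from φ (i , u)) vs) c → E (copies k (part H p i)) r vs c
  forth (j , ws , eq , e) with map-pullback (map₂-fibre proj₁) eq
  ... | zs , refl , refl = j , zs , refl , e
  back : ∀ {i r vs c} → E (copies k (part H p i)) r vs c → E (copies k H) r (map (λ u → from φ (i , u)) vs) c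
  back {i} (j , us , refl , e) =
    j , map proj₁ us , trans (sym (map-∘ (λ u → from φ (i , u)) (j ,_) us)) (map-∘ (j ,_) proj₁ us) , e

part-≤ᴴ : ∀ {C} {X H : Hypergraph C} {m n} {pX : V X → Fin m} {pH : V H → Fin n} {τ : Fin m → Fin n}
  (h : V X → V H) → Injective _≡_ _≡_ h → (∀ x → τ (pX x) ≡ pH (h x)) → ∀ i →
  (∀ r (ws : Vec (Σ (V X) λ x → pX x ≡ i) r) c → E X r (map proj₁ ws) c ⇔ E H r (map (h ∘ proj₁) ws) c) →
  part X pX i ≤ᴴ part H pH (τ i)
part-≤ᴴ {X = X} {H} {pX = pX} {pH} {τ} h h-inj compat i edges =
  F , F-injective , λ r ws c → ⇔-trans (edges r ws c) (E-cong H (map-∘ proj₁ F ws))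
  where
  F : Σ (V X) (λ x → pX x ≡ i) → Σ (V H) (λ w → pH w ≡ τ i)
  F (x , e) = h x , trans (sym (compat x)) (cong τ e)
  F-injective : Injective _≡_ _≡_ F
  F-injective {x , e} {_ , e′} eq with h-inj (cong proj₁ eq)
  ... | refl = cong (x ,_) (Decidable⇒UIP.≡-irrelevant _≟_ e e′)

part-mono : ∀ {C} {G H : Hypergraph C} {m n} {pG : V G → Fin m} {pH : V H → Fin n} {τ : Fin m → Fin n} →
  (G≤H : G ≤ᴴ H) → (∀ v → τ (pG v) ≡ pH (proj₁ G≤H v)) → ∀ i → part G pG i ≤ᴴ part H pH (τ i)
part-mono {G = G} {H} (f , f-inj , f-edges) compat i = part-≤ᴴ {X = G} {H} f f-inj compat i λ r ws c →
  ⇔-trans (f-edges r (map proj₁ ws) c) (E-cong H (sym (map-∘ f proj₁ ws)))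

module Enlargement {C : Set} {n : ℕ} {Xs Hs : Fin n → Hypergraph C} (Xs≤Hs : ∀ i → Xs i ≤ᴴ Hs i)
  (W : Hypergraph C) (W∈ : W ∈Join Hs) (X : Hypergraph C) (X∈ : X ∈Join Xs) where

  φW : V W ↔ Σ (Fin n) (V ∘ Hs)
  φW = proj₁ W∈

  φX : V X ↔ Σ (Fin n) (V ∘ Xs)
  φX = proj₁ X∈

  W-block : ∀ i r vs c → E W r (map (λ v → from φW (i , v)) vs) c ⇔ E (Hs i) r vs c
  W-block = proj₂ W∈

  X-block : ∀ i r vs c → E X r (map (λ v → from φX (i , v)) vs) c ⇔ E (Xs i) r vs c
  X-block = proj₂ X∈

  embed : ∀ i → V (Xs i) → V (Hs i)
  embed i = proj₁ (Xs≤Hs i)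

  embed-edges : ∀ i r vs c → E (Xs i) r vs c ⇔ E (Hs i) r (map (embed i) vs) c
  embed-edges i = proj₂ (proj₂ (Xs≤Hs i))

  g : V X → V W
  g = from φW ∘ map₂ (embed _) ∘ to φX

  g-injective : Injective _≡_ _≡_ g
  g-injective = to-injective φX ∘ map₂-embed-injective ∘ from-injective φW
    where
    map₂-embed-injective : Injective _≡_ _≡_ (map₂ (embed _))
    map₂-embed-injective {i , x} {_ , y} eq with Σ-≡,≡←≡ eq
    ... | refl , embed-x≡embed-y = cong (i ,_) (proj₁ (proj₂ (Xs≤Hs i)) embed-x≡embed-y)

  Y : Hypergraph C
  Y = record
    { V = V W
    ; E = λ r vs c → (Σ (Vec (V X) r) λ ws → vs ≡ map g ws × E X r ws c)
                   ⊎ (E W r vs c × Σ (Fin n) λ i → Σ (Vec (V (Hs i)) r) λ us → vs ≡ map (λ u → from φW (i , u)) us) }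

  g-preimage : ∀ {i x u} → g x ≡ from φW (i , u) → Σ (V (Xs i)) λ z → x ≡ from φX (i , z) × u ≡ embed i z
  g-preimage {x = x} eq with to φX x in tx | from-injective φW eq
  ... | _ , z | refl = z , sym (to-from φX tx) , refl

  Y-isFinHG : IsFinHG X → IsFinHG W → IsFinHG Y
  Y-isFinHG (_ , (csX , X-colours) , X-valid) (W-size , (csW , W-colours) , W-valid) =
    W-size , (csX ++ csW , colours) , valid
    where
    colours : ∀ r vs c → E Y r vs c → c ∈ csX ++ csW
    colours r _ c (inj₁ (ws , _ , e)) = ∈-++⁺ˡ (X-colours r ws c e)
    colours r vs c (inj₂ (e , _)) = ∈-++⁺ʳ csX (W-colours r vs c e)
    valid : ∀ r vs c → E Y r vs c → 2 ≤ r × Distinct vs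
    valid r _ c (inj₁ (ws , refl , e)) with X-valid r ws c e
    ... | 2≤r , distinct = 2≤r , Distinct-map g-injective {vs = ws} distinct
    valid r vs c (inj₂ (e , _)) = W-valid r vs c e

  Y-block-edge : ∀ i {r vs c} → E Y r (map (λ u → from φW (i , u)) vs) c → E (Hs i) r vs c
  Y-block-edge i {r} {c = c} (inj₁ (ws , eq , e)) with map-pullback (g-preimage {i}) (sym eq)
  ... | zs , refl , refl = proj₁ (embed-edges i r zs c) (proj₁ (X-block i r zs c) e)
  Y-block-edge i {r} {vs} {c} (inj₂ (e , _)) = proj₁ (W-block i r vs c) e

  Y-∈Join : Y ∈Join Hs
  Y-∈Join = φW , λ i r vs c → Y-block-edge i , λ e → inj₂ (proj₂ (W-block i r vs c) e , i , vs , refl)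

  X-edge : ∀ {r ws c} → E Y r (map g ws) c → E X r ws c
  X-edge {r} {c = c} (inj₁ (_ , eq , e)) = subst (λ ws → E X r ws c) (sym (map-injective g-injective eq)) e
  X-edge {r} {c = c} (inj₂ (e , i , _ , eq)) with map-pullback (g-preimage {i}) eq
  ... | zs , refl , refl =
    proj₂ (X-block i r zs c) (proj₂ (embed-edges i r zs c)
      (proj₁ (W-block i r (map (embed i) zs) c) (subst (λ vs → E W r vs c) eq e)))

  X≤Y : X ≤ᴴ Y
  X≤Y = g , g-injective , λ r ws c → (λ e → inj₁ (ws , refl , e)) , X-edge

JoinSubset-mono : ∀ {C} {P : Property C} {n} {Xs Hs : Fin n → Hypergraph C} → InducedHereditary P →
  (∀ i → Xs i ≤ᴴ Hs i) → (W : Hypergraph C) → IsFinHG W → W ∈Join Hs →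
  JoinSubset P Hs → JoinSubset P Xs
JoinSubset-mono hered Xs≤Hs W W-fin W∈ P-Hs X X-fin X∈ =
  hered X Y X-fin Y-fin X≤Y (P-Hs Y Y-fin Y-∈Join)
  where
  open Enlargement Xs≤Hs W W∈ X X∈
  Y-fin : IsFinHG Y
  Y-fin = Y-isFinHG X-fin W-fin

module K₁-in-missed-part {C : Set} {G H : Hypergraph C} {d} {pH : V H → Fin d}
  (G≤H : G ≤ᴴ H) (i₀ : Fin d) (missed : ∀ v → pH (proj₁ G≤H v) ≢ i₀)
  (w₀ : V H) (w₀∈i₀ : pH w₀ ≡ i₀) (X : Hypergraph C) (X∈ : X ∈Join pairFam G K₁) where

  f : V G → V H
  f = proj₁ G≤H

  φX : V X ↔ Σ (Fin 2) (V ∘ pairFam G K₁)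
  φX = proj₁ X∈

  h′ : Σ (Fin 2) (V ∘ pairFam G K₁) → V H
  h′ (zero , v) = f v
  h′ (suc zero , _) = w₀

  h : V X → V H
  h = h′ ∘ to φX

  h′-injective : Injective _≡_ _≡_ h′
  h′-injective {zero , _} {zero , _} eq = cong (zero ,_) (proj₁ (proj₂ G≤H) eq)
  h′-injective {zero , v} {suc zero , _} eq = ⊥-elim (missed v (trans (cong pH eq) w₀∈i₀))
  h′-injective {suc zero , _} {zero , v} eq = ⊥-elim (missed v (trans (cong pH (sym eq)) w₀∈i₀))
  h′-injective {suc zero , _} {suc zero , _} _ = refl

  in-K₁ : ∀ t → pH (h′ t) ≡ i₀ → t ≡ (suc zero , tt)
  in-K₁ (zero , v) e = ⊥-elim (missed v e)
  in-K₁ (suc zero , _) _ = refl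

  in-G : ∀ t → pH (h′ t) ≢ i₀ → Σ (V G) λ v → t ≡ (zero , v)
  in-G (zero , v) _ = v , refl
  in-G (suc zero , _) ≢i₀ = ⊥-elim (≢i₀ w₀∈i₀)

  PartX : Fin d → Set
  PartX i = Σ (V X) λ x → pH (h x) ≡ i

  K₁-side : (w : PartX i₀) → to φX (proj₁ w) ≡ (suc zero , tt)
  K₁-side (x , e) = in-K₁ (to φX x) e

  G-side : ∀ {i} → i ≢ i₀ → (w : PartX i) → Σ (V G) λ v → to φX (proj₁ w) ≡ (zero , v)
  G-side i≢i₀ (x , e) = in-G (to φX x) (λ e₀ → i≢i₀ (trans (sym e) e₀))

  -- Part i₀ of X consists of the vertex of K₁ alone, and edges have two distinct vertices.
  part-edges : IsFinHG X → IsFinHG H → ∀ i r (ws : Vec (PartX i) r) c →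
    E X r (map proj₁ ws) c ⇔ E H r (map (h ∘ proj₁) ws) c
  part-edges X-fin H-fin i r ws c with i ≟ i₀
  ... | yes refl = ⊥-elim ∘ X-nonconstant , ⊥-elim ∘ H-nonconstant
    where
    X-nonconstant : ¬ E X r (map proj₁ ws) c
    X-nonconstant e = edge-nonconstant X-fin e (from φX (suc zero , tt)) λ m →
      trans (lookup-map m proj₁ ws) (sym (to-from φX (K₁-side (lookup ws m))))
    H-nonconstant : ¬ E H r (map (h ∘ proj₁) ws) c
    H-nonconstant e = edge-nonconstant H-fin e w₀ λ m →
      trans (lookup-map m (h ∘ proj₁) ws) (cong h′ (K₁-side (lookup ws m)))
  ... | no i≢i₀ =
    ⇔-trans (E-cong X X-in-G) (⇔-trans (proj₂ X∈ zero r us c)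
      (⇔-trans (proj₂ (proj₂ G≤H) r us c) (E-cong H (sym H-from-G))))
    where
    us : Vec (V G) r
    us = map (proj₁ ∘ G-side i≢i₀) ws
    X-in-G : map proj₁ ws ≡ map (λ u → from φX (zero , u)) us
    X-in-G = trans (map-cong (λ w → sym (to-from φX (proj₂ (G-side i≢i₀ w)))) ws) (map-∘ _ _ ws)
    H-from-G : map (h ∘ proj₁) ws ≡ map f us
    H-from-G = trans (map-cong (λ w → cong h′ (proj₂ (G-side i≢i₀ w))) ws) (map-∘ _ _ ws)

missed-part⇒G*K₁⊆P : ∀ {C} {P : Property C} {G H : Hypergraph C} {d} {pH : V H → Fin d} →
  InducedHereditary P → IsFinHG H → IsDecomp P H d pH → (G≤H : G ≤ᴴ H) →
  (i₀ : Fin d) → (∀ v → pH (proj₁ G≤H v) ≢ i₀) → JoinSubset P (pairFam G K₁)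
missed-part⇒G*K₁⊆P {H = H} {pH = pH} hered H-fin (H-onto , H-dec) G≤H i₀ missed X X-fin X∈ =
  JoinSubset-mono hered parts-≤ (copies 1 H) (copies-isFinHG 1 H-fin) (copies-∈Join-parts H pH 1)
    (H-dec 1 (s≤s z≤n)) X X-fin (∈Join-parts X (pH ∘ h))
  where
  open K₁-in-missed-part {H = H} {pH = pH} G≤H i₀ missed (proj₁ (H-onto i₀)) (proj₂ (H-onto i₀)) X X∈
  parts-≤ : ∀ i → part X (pH ∘ h) i ≤ᴴ copies 1 (part H pH i)
  parts-≤ i = ≤ᴴ-trans {F = part X (pH ∘ h) i} {part H pH i} {copies 1 (part H pH i)}
    (part-≤ᴴ {X = X} {H} {τ = id} h (to-injective φX ∘ h′-injective) (λ _ → refl) i (part-edges X-fin H-fin i))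
    (≤ᴴ-copies {G = part H pH i} zero)

Strict⇒covers-parts : ∀ {C} {P : Property C} {G H : Hypergraph C} {d} {pH : V H → Fin d} →
  InducedHereditary P → IsFinHG G → IsFinHG H → Strict P G → IsDecomp P H d pH →
  (G≤H : G ≤ᴴ H) → ∀ i → ∃ λ v → pH (proj₁ G≤H v) ≡ i
Strict⇒covers-parts {pH = pH} hered ((_ , φG) , _) H-fin (_ , ¬G*K₁⊆P) H-dec G≤H@(f , _) i
  with any? (λ m → pH (f (from φG m)) ≟ i)
... | yes (m , hit) = from φG m , hit
... | no ¬hit = ⊥-elim (¬G*K₁⊆P (missed-part⇒G*K₁⊆P hered H-fin H-dec G≤H i missed))
  where
  missed : ∀ v → pH (f v) ≢ i
  missed v hit = ¬hit (to φG v , subst (λ u → pH (f u) ≡ i) (sym (strictlyInverseʳ φG v)) hit)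

IsDecomp-restrict : ∀ {C} {P : Property C} {G H : Hypergraph C} {d} {pH : V H → Fin d} →
  InducedHereditary P → IsFinHG H → (G≤H : G ≤ᴴ H) → IsDecomp P H d pH →
  (∀ i → ∃ λ v → pH (proj₁ G≤H v) ≡ i) → IsDecomp P G d (pH ∘ proj₁ G≤H)
IsDecomp-restrict {G = G} {H} {pH = pH} hered H-fin G≤H (_ , H-dec) covers = covers , λ k k≥1 →
  JoinSubset-mono hered
    (λ i → copies-mono {G = part G _ i} {part H pH i} (part-mono {G = G} {H} {τ = id} G≤H (λ _ → refl) i))
    (copies k H) (copies-isFinHG k H-fin) (copies-∈Join-parts H pH k) (H-dec k k≥1)

DecIs-unique : ∀ {C} {P : Property C} {G : Hypergraph C} {m n} → DecIs P G m → DecIs P G n → m ≡ n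
DecIs-unique (inj₁ (_ , refl)) (inj₁ (_ , refl)) = refl
DecIs-unique (inj₁ (¬PG , _)) (inj₂ (PG , _)) = ⊥-elim (¬PG PG)
DecIs-unique (inj₂ (PG , _)) (inj₁ (¬PG , _)) = ⊥-elim (¬PG PG)
DecIs-unique (inj₂ (_ , (p , p-dec) , p-max)) (inj₂ (_ , (q , q-dec) , q-max)) =
  ≤-antisym (q-max _ p p-dec) (p-max _ q q-dec)

relabelling : ∀ {A : Set} {n} {p q₁ q₂ : A → Fin n} (σ₁ σ₂ : Fin n ↔ Fin n) →
  (∀ a → q₁ a ≡ to σ₁ (p a)) → (∀ a → q₂ a ≡ to σ₂ (p a)) →
  ∀ a → to (↔-trans (↔-sym σ₁) σ₂) (q₁ a) ≡ q₂ a
relabelling {p = p} {q₁} {q₂} σ₁ σ₂ q₁≡σ₁p q₂≡σ₂p a = begin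
  to σ₂ (from σ₁ (q₁ a))         ≡⟨ cong (to σ₂ ∘ from σ₁) (q₁≡σ₁p a) ⟩
  to σ₂ (from σ₁ (to σ₁ (p a)))  ≡⟨ cong (to σ₂) (strictlyInverseʳ σ₁ (p a)) ⟩
  to σ₂ (p a)                    ≡⟨ q₂≡σ₂p a ⟨
  q₂ a                           ∎
  where open ≡-Reasoning

lemma9 : {C : Set} (P : Property C) → IsProperty P → Additive P → InducedHereditary P →
    (d : ℕ) → DecProp P d →
    (G H : Hypergraph C) → IsFinHG G → IsFinHG H →
    Strict P G → Strict P H →
    UniquelyDecomposable P G → UniquelyDecomposable P H →
    DecIs P G d → DecIs P H d →
    G ≤ᴴ H →
    (pG : V G → Fin d) → IsDecomp P G d pG →
    (pH : V H → Fin d) → IsDecomp P H d pH →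
    Σ (Fin d → Fin d) λ τ → Injective _≡_ _≡_ τ ×
      (∀ i → part G pG i ≤ᴴ part H pH (τ i))
lemma9 P _ _ hered d _ G H G-fin H-fin G-strict _ (n , G-dec-n , p , _ , p-unique) _ G-dec-d _
  G≤H pG pG-dec pH pH-dec with DecIs-unique G-dec-n G-dec-d
... | refl = to τ , to-injective τ , part-mono {G = G} {H} G≤H (relabelling σ₁ σ₂ σ₁-relabels σ₂-relabels)
  where
  pH∘f-dec : IsDecomp P G n (pH ∘ proj₁ G≤H)
  pH∘f-dec = IsDecomp-restrict hered H-fin G≤H pH-dec
    (Strict⇒covers-parts hered G-fin H-fin G-strict pH-dec G≤H)
  σ₁ σ₂ : Fin n ↔ Fin n
  σ₁ = proj₁ (p-unique pG pG-dec)
  σ₂ = proj₁ (p-unique (pH ∘ proj₁ G≤H) pH∘f-dec)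
  σ₁-relabels : ∀ v → pG v ≡ to σ₁ (p v)
  σ₁-relabels = proj₂ (p-unique pG pG-dec)
  σ₂-relabels : ∀ v → pH (proj₁ G≤H v) ≡ to σ₂ (p v)
  σ₂-relabels = proj₂ (p-unique (pH ∘ proj₁ G≤H) pH∘f-dec)
  τ : Fin n ↔ Fin n
  τ = ↔-trans (↔-sym σ₁) σ₂
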